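{- Let $n=n_1+\cdots+n_r$ with $r\ge1$ and positive integers $n_i$, $N_0=0$, $N_i=n_1+\cdots+n_i$, $b_1,\dots,b_n$ positive integers, and $\Delta\subset\mathbb{R}^{n+1}$ the convex hull of $V_0,\dots,V_{n+r+1}$ as in the context. Then the number of codimension $1$ faces of $\Delta$ not containing the origin is $\prod_{i=1}^r(1+n_i)$.
   Context: $V_0=0$; $V_1,\dots,V_{n+1}$ are the standard basis vectors $e_1,\dots,e_{n+1}$ of $\mathbb{R}^{n+1}$; and for $1\le i\le r$, $V_{n+1+i}=e_{n+1}-\sum_{l=N_{i-1}+1}^{N_i}b_le_l$.
   Formalization: Δ is taken in ℚ^(n+1) instead of $\mathbb{R}^{n+1}$, so the supporting hyperplanes and the affine dependencies that define its faces and their dimensions have rational coefficients. -}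

module Defs where

open import Data.Nat as ℕ using (ℕ; zero; suc; _≤ᵇ_; _<ᵇ_)
open import Data.Bool using (Bool; true; false; if_then_else_; _∧_)
open import Data.Fin using (Fin; zero; suc; toℕ; splitAt)
open import Data.Fin.Subset using (Subset; _∈_; _∉_)
open import Data.Vec using (Vec; []; _∷_)
import Data.Vec as Vec
open import Data.Vec.Functional using (Vector)
import Data.Vec.Functional as VF
open import Data.Integer using (+_)
open import Data.Rational using (ℚ; 0ℚ; 1ℚ; _+_; _*_; -_; _≤_; _/_)
open import Data.Sum using (inj₁; inj₂)
open import Data.Product using (Σ; _×_; ∃)
open import Data.List using (List)
open import Data.List.Relation.Unary.Unique.Propositional using (Unique)
import Data.List.Membership.Propositional as LM
open import Relation.Binary.PropositionalEquality using (_≡_)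
open import Relation.Nullary using (¬_)
open import Function.Bundles using (_⇔_)

ℕ→ℚ : ℕ → ℚ
ℕ→ℚ k = (+ k) / 1

total : ∀ {r} → Vec ℕ r → ℕ
total = Vec.sum

prodSuc : ∀ {r} → Vec ℕ r → ℕ
prodSuc [] = 1
prodSuc (x ∷ xs) = suc x ℕ.* prodSuc xs

-- partial sums: psum ns i = N_i = n₁ + ⋯ + n_i  (N_0 = 0)
psum : ∀ {r} → Vec ℕ r → ℕ → ℕ
psum [] _ = 0
psum (x ∷ xs) zero = 0
psum (x ∷ xs) (suc i) = x ℕ.+ psum xs i

-- Coordinates of ℝ^{n+1} (here ℚ^{n+1}) are indexed by Fin (n + 1):
-- the coordinate (inj₁ l) with l : Fin n is the (l+1)-st one (l+1 = 1,…,n),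
-- the coordinate (inj₂ zero) is the (n+1)-st one.
Pt : ℕ → Set
Pt n = Vector ℚ (n ℕ.+ 1)

-- does the 0-based coordinate index l (i.e. e_{l+1}) lie in block i (0-based),
-- i.e. N_i + 1 ≤ l + 1 ≤ N_{i+1} ?
inBlock : ∀ {r} → Vec ℕ r → ℕ → Fin r → Bool
inBlock ns l i = (psum ns (toℕ i) ≤ᵇ l) ∧ (l <ᵇ psum ns (suc (toℕ i)))

-- standard basis vector e_{k+1}
basis : ∀ n → Fin (n ℕ.+ 1) → Pt n
basis n k c = if (toℕ k ℕ.≡ᵇ toℕ c) then 1ℚ else 0ℚ

-- V_{n+1+(i+1)} = e_{n+1} - Σ_{l = N_i + 1}^{N_{i+1}} b_l e_l   (i 0-based)
blockVertex : ∀ {r} (ns : Vec ℕ r) (b : Fin (total ns) → ℕ) → Fin r → Pt (total ns)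
blockVertex ns b i c with splitAt (total ns) c
... | inj₁ l = if inBlock ns (toℕ l) i then - ℕ→ℚ (b l) else 0ℚ
... | inj₂ _ = 1ℚ

-- vertex indices 0,…,n+r+1 : Fin ((1 + (n + 1)) + r)
--   index 0 ↦ V_0 = 0, index k (1 ≤ k ≤ n+1) ↦ V_k = e_k,
--   index n+1+i (1 ≤ i ≤ r) ↦ V_{n+1+i}
Idx : ∀ {r} → Vec ℕ r → Set
Idx {r} ns = Fin ((1 ℕ.+ (total ns ℕ.+ 1)) ℕ.+ r)

V : ∀ {r} (ns : Vec ℕ r) (b : Fin (total ns) → ℕ) → Idx ns → Pt (total ns)
V {r} ns b j with splitAt (1 ℕ.+ (total ns ℕ.+ 1)) j
... | inj₁ zero = λ _ → 0ℚ
... | inj₁ (suc k) = basis (total ns) k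
... | inj₂ i = blockVertex ns b i

Σℚ : ∀ {k} → Vector ℚ k → ℚ
Σℚ = VF.foldr _+_ 0ℚ

dot : ∀ {m} → Vector ℚ m → Vector ℚ m → ℚ
dot a x = Σℚ (λ c → a c * x c)

AffIndep : ∀ {m k} → (Fin k → Vector ℚ m) → Set
AffIndep {m} {k} p =
  (λ' : Fin k → ℚ) → Σℚ λ' ≡ 0ℚ → (∀ c → Σℚ (λ i → λ' i * p i c) ≡ 0ℚ) →
  ∀ i → λ' i ≡ 0ℚ

-- The face of Δ = conv(V_j) cut out by the supporting hyperplane a·x = c
-- (a ≠ 0, a·x ≤ c on Δ) whose vertex set is exactly S.
-- (a·x ≤ c on Δ ⇔ a·V_j ≤ c for all j, since Δ is the convex hull.)
IsProperFaceWithVertices : ∀ {m} {I : ℕ} → (Fin I → Vector ℚ m) → Subset I → Set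
IsProperFaceWithVertices {m} {I} W S =
  Σ (Vector ℚ m) λ a → Σ ℚ λ c →
    (¬ (∀ t → a t ≡ 0ℚ)) ×
    (∀ j → dot a (W j) ≤ c) ×
    (∀ j → (dot a (W j) ≡ c) ⇔ (j ∈ S))

HasDim : ∀ {m} {I : ℕ} → (Fin I → Vector ℚ m) → Subset I → ℕ → Set
HasDim {m} {I} W S d =
  (Σ (Fin (suc d) → Fin I) λ f → (∀ i → f i ∈ S) × AffIndep (λ i → W (f i))) ×
  ¬ (Σ (Fin (suc (suc d)) → Fin I) λ f → (∀ i → f i ∈ S) × AffIndep (λ i → W (f i)))

-- S is the vertex set of a codimension-1 face (facet) of Δ ⊂ ℚ^{n+1}
-- (dim Δ = n+1, so facets have dimension n) not containing the origin V_0.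
IsFacetAvoidingOrigin : ∀ {r} (ns : Vec ℕ r) (b : Fin (total ns) → ℕ) → Subset _ → Set
IsFacetAvoidingOrigin ns b S =
  IsProperFaceWithVertices (V ns b) S ×
  HasDim (V ns b) S (total ns) ×
  (zero ∉ S)

-- "the number of elements of {x ∣ P x} is N" for a predicate on a type
-- with decidable equality-free listing: a duplicate-free list enumerating P
HasCount : ∀ {A : Set} → (A → Set) → ℕ → Set
HasCount {A} P N =
  Σ (List A) λ xs → Unique xs × (Data.List.length xs ≡ N) ×
    (∀ x → P x ⇔ (x LM.∈ xs))

module Submission where

open import Defs
open import Data.Nat as ℕ using (ℕ; zero; suc; _<ᵇ_; _≤ᵇ_)
import Data.Nat.Properties as ℕP
open import Data.Fin using (Fin; zero; suc; _↑ˡ_; _↑ʳ_; toℕ; splitAt; join; punchIn; punchOut; fromℕ<)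
open import Data.Fin.Properties as FinP using (_≟_; any?; suc-injective)
open import Data.Fin.Subset using (Subset; _∈_; _∉_)
open import Data.Fin.Subset.Properties using (_∈?_; ⊆-antisym)
open import Data.Vec using (Vec; []; _∷_; lookup; tabulate)
import Data.Vec.Properties as VecP
open import Data.Vec.Functional using (Vector; removeAt)
open import Data.Vec.Relation.Unary.All using (All)
open import Data.Vec.Relation.Unary.All.Properties using (lookup⁺)

open import Data.Rational using (ℚ; 0ℚ; 1ℚ; _+_; _*_; -_; 1/_; NonZero; Positive; positive; negative)
import Data.Rational.Properties as ℚP
open import Algebra.Properties.CommutativeMonoid.Sum ℚP.+-0-commutativeMonoid
  using (sum-remove; sum-cong-≗; sum-replicate-zero; ∑-distrib-+)
open import Data.Bool using (Bool; true; false; if_then_else_; not; T; _∧_)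
open import Data.Maybe as Maybe using (Maybe; just; nothing; maybe)
open import Data.Sum using (inj₁; inj₂; [_,_])
open import Data.Product using (Σ; ∃; _×_; _,_; proj₁; proj₂)
open import Data.Unit using (⊤; tt)
open import Data.List as List using (List; length; cartesianProduct; allFin; map)
import Data.List.Properties as ListP
open import Data.List.Membership.Propositional using () renaming (_∈_ to _∈ₗ_)
open import Data.List.Membership.Propositional.Properties using (∈-cartesianProduct⁺; ∈-allFin; ∈-map⁺; ∈-map⁻)
open import Data.List.Relation.Unary.Any using (here)
open import Data.List.Relation.Unary.Unique.Propositional using (Unique)
import Data.List.Relation.Unary.AllPairs as AllPairs
import Data.List.Relation.Unary.All as ListAll
open import Data.List.Relation.Unary.Unique.Propositional.Properties using (cartesianProduct⁺; allFin⁺; map⁺)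
open import Function.Base using (id; _∘_)
open import Function.Bundles using (_⇔_; mk⇔; Equivalence)
import Function.Properties.Equivalence as ⇔
open import Relation.Binary.Definitions using (tri<; tri≈; tri>)
open import Relation.Binary.PropositionalEquality
  using (_≡_; _≢_; _≗_; refl; sym; trans; cong; cong₂; subst; subst₂; module ≡-Reasoning)
open import Relation.Nullary using (¬_; yes; no; ¬?; does; contradiction)
open import Relation.Nullary.Decidable using (dec-true; dec-false; dec⇒maybe; decidable-stable)

-- A facet F of Δ avoiding the origin lies on a hyperplane a·x = h with h > 0.  If F contains
-- wᵢ = e_{n+1} − Σ_{l ∈ block i} b_l e_l, then some e_l of block i is missing from F, for otherwise
-- a·wᵢ = −h Σ_l b_l + a_{n+1} < h.  Sending each e_k ∈ F to the coordinate k and each wᵢ ∈ F to the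
-- coordinate of a missing e_l of its block is injective on F; as F has n + 1 affinely independent
-- vertices, every one of the n + 1 coordinates is hit.  Hence e_{n+1} ∈ F, and for every block i
-- either F contains all e_l of the block but not wᵢ, or wᵢ and all e_l of the block except one.
-- Conversely each of these ∏ (1 + nᵢ) configurations is a facet: its n + 1 vertices are affinely
-- independent, and all of them lie on a·x = 1, where a is (1, …, 1) corrected at the omitted e_l,
-- while the remaining vertices lie strictly below.

Σℚ-zero : ∀ {k} {f : Vector ℚ k} → (∀ i → f i ≡ 0ℚ) → Σℚ f ≡ 0ℚ
Σℚ-zero {k} f≡0 = trans (sum-cong-≗ f≡0) (sum-replicate-zero k)

Σℚ-single : ∀ {k} (f : Vector ℚ k) i → (∀ j → j ≢ i → f j ≡ 0ℚ) → Σℚ f ≡ f i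
Σℚ-single {suc k} f i f≡0 = begin
  Σℚ f                     ≡⟨ sum-remove {i = i} f ⟩
  f i + Σℚ (removeAt f i)  ≡⟨ cong (f i +_) (Σℚ-zero (λ j → f≡0 _ (FinP.punchInᵢ≢i i j))) ⟩
  f i + 0ℚ                 ≡⟨ ℚP.+-identityʳ (f i) ⟩
  f i                      ∎
  where open ≡-Reasoning

Σℚ-pair : ∀ {k} (f : Vector ℚ k) {i j} (i≢j : i ≢ j) → (∀ x → x ≢ i → x ≢ j → f x ≡ 0ℚ) →
          Σℚ f ≡ f i + f j
Σℚ-pair {suc k} f {i} {j} i≢j f≡0 = begin
  Σℚ f                                   ≡⟨ sum-remove {i = i} f ⟩
  f i + Σℚ (removeAt f i)                ≡⟨ cong (f i +_) (Σℚ-single _ (punchOut i≢j) rest≡0) ⟩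
  f i + f (punchIn i (punchOut i≢j))     ≡⟨ cong (λ x → f i + f x) (FinP.punchIn-punchOut i≢j) ⟩
  f i + f j                              ∎
  where
  open ≡-Reasoning
  rest≡0 : ∀ x → x ≢ punchOut i≢j → f (punchIn i x) ≡ 0ℚ
  rest≡0 x x≢j′ = f≡0 _ (FinP.punchInᵢ≢i i x) λ x↦j →
    x≢j′ (FinP.punchIn-injective i x _ (trans x↦j (sym (FinP.punchIn-punchOut i≢j))))

dot-cong : ∀ {m} (a : Vector ℚ m) {x y : Vector ℚ m} → x ≗ y → dot a x ≡ dot a y
dot-cong a x≗y = sum-cong-≗ (cong (a _ *_) ∘ x≗y)

dot-zeroʳ : ∀ {m} (a : Vector ℚ m) → dot a (λ _ → 0ℚ) ≡ 0ℚ
dot-zeroʳ a = Σℚ-zero (ℚP.*-zeroʳ ∘ a)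

basis-diag : ∀ n k → basis n k k ≡ 1ℚ
basis-diag n k with toℕ k ℕ.≡ᵇ toℕ k | ℕP.≡⇒≡ᵇ (toℕ k) (toℕ k) refl
... | true | _ = refl

basis-off : ∀ n k c → c ≢ k → basis n k c ≡ 0ℚ
basis-off n k c c≢k with toℕ k ℕ.≡ᵇ toℕ c in eq
... | false = refl
... | true  = contradiction (FinP.toℕ-injective (ℕP.≡ᵇ⇒≡ (toℕ k) (toℕ c) (subst T (sym eq) tt))) (c≢k ∘ sym)

dot-basis : ∀ n (a : Vector ℚ (n ℕ.+ 1)) k → dot a (basis n k) ≡ a k
dot-basis n a k = begin
  dot a (basis n k)   ≡⟨ Σℚ-single _ k (λ c c≢k → trans (cong (a c *_) (basis-off n k c c≢k)) (ℚP.*-zeroʳ (a c))) ⟩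
  a k * basis n k k   ≡⟨ cong (a k *_) (basis-diag n k) ⟩
  a k * 1ℚ            ≡⟨ ℚP.*-identityʳ (a k) ⟩
  a k                 ∎
  where open ≡-Reasoning

Σℚ-↑ : ∀ m {k} (f : Vector ℚ (m ℕ.+ k)) → Σℚ f ≡ Σℚ (f ∘ (_↑ˡ k)) + Σℚ (f ∘ (m ↑ʳ_))
Σℚ-↑ zero    f = sym (ℚP.+-identityˡ (Σℚ f))
Σℚ-↑ (suc m) f = trans (cong (f zero +_) (Σℚ-↑ m (f ∘ suc))) (sym (ℚP.+-assoc (f zero) _ _))

affIndep⇒injective : ∀ {m k} {p : Fin k → Vector ℚ m} → AffIndep p → ∀ {i j} → p i ≗ p j → i ≡ j
affIndep⇒injective {k = k} {p} indep {i} {j} pᵢ≗pⱼ with i ≟ j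
... | yes i≡j = i≡j
... | no i≢j = contradiction (indep t Σt≡0 Σtp≡0 i) tᵢ≢0
  where
  open ≡-Reasoning
  t : Fin k → ℚ
  t x = if does (x ≟ i) then 1ℚ else if does (x ≟ j) then - 1ℚ else 0ℚ
  tᵢ : t i ≡ 1ℚ
  tᵢ rewrite dec-true (i ≟ i) refl = refl
  tⱼ : t j ≡ - 1ℚ
  tⱼ rewrite dec-false (j ≟ i) (i≢j ∘ sym) | dec-true (j ≟ j) refl = refl
  t-off : ∀ x → x ≢ i → x ≢ j → t x ≡ 0ℚ
  t-off x x≢i x≢j rewrite dec-false (x ≟ i) x≢i | dec-false (x ≟ j) x≢j = refl
  tᵢ≢0 : t i ≢ 0ℚ
  tᵢ≢0 tᵢ≡0 with () ← trans (sym tᵢ) tᵢ≡0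
  Σt≡0 : Σℚ t ≡ 0ℚ
  Σt≡0 = begin
    Σℚ t         ≡⟨ Σℚ-pair t i≢j t-off ⟩
    t i + t j    ≡⟨ cong₂ _+_ tᵢ tⱼ ⟩
    1ℚ + - 1ℚ    ≡⟨ ℚP.+-inverseʳ 1ℚ ⟩
    0ℚ           ∎
  Σtp≡0 : ∀ c → Σℚ (λ x → t x * p x c) ≡ 0ℚ
  Σtp≡0 c = begin
    Σℚ (λ x → t x * p x c)           ≡⟨ Σℚ-pair _ i≢j (λ x x≢i x≢j → trans (cong (_* p x c) (t-off x x≢i x≢j))
                                                                         (ℚP.*-zeroˡ (p x c))) ⟩
    t i * p i c + t j * p j c        ≡⟨ cong₂ (λ u v → u * p i c + v * p j c) tᵢ tⱼ ⟩
    1ℚ * p i c + - 1ℚ * p j c        ≡⟨ cong (λ v → 1ℚ * p i c + - 1ℚ * v) (sym (pᵢ≗pⱼ c)) ⟩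
    1ℚ * p i c + - 1ℚ * p i c        ≡⟨ ℚP.*-distribʳ-+ (p i c) 1ℚ (- 1ℚ) ⟨
    (1ℚ + - 1ℚ) * p i c              ≡⟨ cong (_* p i c) (ℚP.+-inverseʳ 1ℚ) ⟩
    0ℚ * p i c                       ≡⟨ ℚP.*-zeroˡ (p i c) ⟩
    0ℚ                               ∎

affIndep⇒≤ : ∀ {m k d} {p : Fin k → Vector ℚ m} → AffIndep p →
             (g : Fin k → Fin d) → (∀ {i j} → g i ≡ g j → p i ≗ p j) → k ℕ.≤ d
affIndep⇒≤ indep g faithful = FinP.injective⇒≤ (affIndep⇒injective indep ∘ faithful)

affIndep⇒< : ∀ {m k d} {p : Fin k → Vector ℚ m} → AffIndep p →
             (g : Fin k → Fin d) → (∀ {i j} → g i ≡ g j → p i ≗ p j) →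
             (q : Fin d) → (∀ i → g i ≢ q) → k ℕ.< d
affIndep⇒< {d = suc d} indep g faithful q g≢q =
  ℕ.s≤s (affIndep⇒≤ indep (λ i → punchOut (g≢q i ∘ sym))
                           (λ e → faithful (FinP.punchOut-injective (g≢q _ ∘ sym) (g≢q _ ∘ sym) e)))

ℕ→ℚ-pos : ∀ k → 0 ℕ.< k → Positive (ℕ→ℚ k)
ℕ→ℚ-pos (suc k) _ = ℚP.normalize-pos (suc k) 1

p*q≡0⇒p≡0 : ∀ p q .{{_ : NonZero q}} → p * q ≡ 0ℚ → p ≡ 0ℚ
p*q≡0⇒p≡0 p q pq≡0 = begin
  p                  ≡⟨ ℚP.*-identityʳ p ⟨
  p * 1ℚ             ≡⟨ cong (p *_) (ℚP.*-inverseʳ q) ⟨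
  p * (q * 1/ q)     ≡⟨ ℚP.*-assoc p q (1/ q) ⟨
  (p * q) * 1/ q     ≡⟨ cong (_* 1/ q) pq≡0 ⟩
  0ℚ * 1/ q          ≡⟨ ℚP.*-zeroˡ (1/ q) ⟩
  0ℚ                 ∎
  where open ≡-Reasoning

p*[1/q]*-q≡-p : ∀ p q .{{_ : NonZero q}} → (p * 1/ q) * (- q) ≡ - p
p*[1/q]*-q≡-p p q = begin
  (p * 1/ q) * (- q)     ≡⟨ ℚP.neg-distribʳ-* (p * 1/ q) q ⟨
  - ((p * 1/ q) * q)     ≡⟨ cong -_ (ℚP.*-assoc p (1/ q) q) ⟩
  - (p * (1/ q * q))     ≡⟨ cong (λ z → - (p * z)) (ℚP.*-inverseˡ q) ⟩
  - (p * 1ℚ)             ≡⟨ cong -_ (ℚP.*-identityʳ p) ⟩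
  - p                    ∎
  where open ≡-Reasoning

-- The order on ℚ is opened only locally: the statement of proposition3p5 uses ℕ's _≤_ and _<_.
module _ where
  open import Data.Rational using (_≤_; _<_)

  Σℚ-nonPos : ∀ {k} (f : Vector ℚ k) → (∀ i → f i ≤ 0ℚ) → Σℚ f ≤ 0ℚ
  Σℚ-nonPos {zero}  f f≤0 = ℚP.≤-refl
  Σℚ-nonPos {suc k} f f≤0 =
    subst (Σℚ f ≤_) (ℚP.+-identityʳ 0ℚ) (ℚP.+-mono-≤ (f≤0 zero) (Σℚ-nonPos (f ∘ suc) (f≤0 ∘ suc)))

  Σℚ-neg : ∀ {k} (f : Vector ℚ k) → (∀ i → f i ≤ 0ℚ) → ∀ i → f i < 0ℚ → Σℚ f < 0ℚ
  Σℚ-neg {suc k} f f≤0 i fi<0 = begin-strict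
    Σℚ f                     ≡⟨ sum-remove {i = i} f ⟩
    f i + Σℚ (removeAt f i)  <⟨ ℚP.+-mono-<-≤ fi<0 (Σℚ-nonPos _ (f≤0 ∘ punchIn i)) ⟩
    0ℚ + 0ℚ                  ≡⟨ ℚP.+-identityʳ 0ℚ ⟩
    0ℚ                       ∎
    where open ℚP.≤-Reasoning

  ≤∧≢⇒< : ∀ {p q : ℚ} → p ≤ q → p ≢ q → p < q
  ≤∧≢⇒< {p} {q} p≤q p≢q with ℚP.<-cmp p q
  ... | tri< p<q _ _ = p<q
  ... | tri≈ _ p≡q _ = contradiction p≡q p≢q
  ... | tri> _ _ q<p = contradiction (ℚP.<-≤-trans q<p p≤q) (ℚP.<-irrefl refl)

  p<0⇒p+1<1 : ∀ {p} → p < 0ℚ → p + 1ℚ < 1ℚ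
  p<0⇒p+1<1 {p} p<0 = subst (p + 1ℚ <_) (ℚP.+-identityˡ 1ℚ) (ℚP.+-monoˡ-< 1ℚ p<0)

  Tight : Bool → ℚ → Set
  Tight true  x = x ≡ 1ℚ
  Tight false x = x < 1ℚ

  Tight⇒≤ : ∀ {β x} → Tight β x → x ≤ 1ℚ
  Tight⇒≤ {true}  x≡1 = ℚP.≤-reflexive x≡1
  Tight⇒≤ {false} x<1 = ℚP.<⇒≤ x<1

  Tight⇒⇔ : ∀ {β x} → Tight β x → (x ≡ 1ℚ) ⇔ (β ≡ true)
  Tight⇒⇔ {true}  x≡1 = mk⇔ (λ _ → refl) (λ _ → x≡1)
  Tight⇒⇔ {false} x<1 = mk⇔ (λ x≡1 → contradiction x≡1 (ℚP.<⇒≢ x<1)) (λ ())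

∈-tabulate : ∀ {k} (f : Fin k → Bool) j → j ∈ tabulate f ⇔ f j ≡ true
∈-tabulate f j = mk⇔ (λ j∈ → trans (sym (VecP.lookup∘tabulate f j)) (VecP.[]=⇒lookup j∈))
                     (λ fj → VecP.lookup⇒[]= j (tabulate f) (trans (VecP.lookup∘tabulate f j) fj))

length-cartesianProduct : ∀ {A B : Set} (xs : List A) (ys : List B) →
                          length (cartesianProduct xs ys) ≡ length xs ℕ.* length ys
length-cartesianProduct List.[] ys = refl
length-cartesianProduct (x List.∷ xs) ys = begin
  length (List.map (x ,_) ys List.++ cartesianProduct xs ys)
    ≡⟨ ListP.length-++ (List.map (x ,_) ys) ⟩
  length (List.map (x ,_) ys) ℕ.+ length (cartesianProduct xs ys)
    ≡⟨ cong₂ ℕ._+_ (ListP.length-map (x ,_) ys) (length-cartesianProduct xs ys) ⟩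
  length ys ℕ.+ length xs ℕ.* length ys
    ∎
  where open ≡-Reasoning

Choice : ∀ {r} → Vec ℕ r → Set
Choice []       = ⊤
Choice (k ∷ ks) = Fin (suc k) × Choice ks

choiceAt : ∀ {r} {ns : Vec ℕ r} → Choice ns → (i : Fin r) → Fin (suc (lookup ns i))
choiceAt {ns = _ ∷ _} (x , c) zero    = x
choiceAt {ns = _ ∷ _} (x , c) (suc i) = choiceAt c i

tabulateChoice : ∀ {r} {ns : Vec ℕ r} → ((i : Fin r) → Fin (suc (lookup ns i))) → Choice ns
tabulateChoice {ns = []}    f = tt
tabulateChoice {ns = _ ∷ _} f = f zero , tabulateChoice (f ∘ suc)

choiceAt-tabulate : ∀ {r} {ns : Vec ℕ r} f i → choiceAt {ns = ns} (tabulateChoice f) i ≡ f i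
choiceAt-tabulate {ns = _ ∷ _} f zero    = refl
choiceAt-tabulate {ns = _ ∷ ks} f (suc i) = choiceAt-tabulate {ns = ks} (f ∘ suc) i

choice-ext : ∀ {r} {ns : Vec ℕ r} {c c′ : Choice ns} → (∀ i → choiceAt c i ≡ choiceAt c′ i) → c ≡ c′
choice-ext {ns = []}    _  = refl
choice-ext {ns = _ ∷ _} eq = cong₂ _,_ (eq zero) (choice-ext (eq ∘ suc))

allChoices : ∀ {r} (ns : Vec ℕ r) → List (Choice ns)
allChoices []       = tt List.∷ List.[]
allChoices (k ∷ ks) = cartesianProduct (allFin (suc k)) (allChoices ks)

∈-allChoices : ∀ {r} (ns : Vec ℕ r) (c : Choice ns) → c ∈ₗ allChoices ns
∈-allChoices []       tt      = here refl
∈-allChoices (k ∷ ks) (x , c) = ∈-cartesianProduct⁺ (∈-allFin x) (∈-allChoices ks c)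

allChoices-unique : ∀ {r} (ns : Vec ℕ r) → Unique (allChoices ns)
allChoices-unique []       = ListAll.[] AllPairs.∷ AllPairs.[]
allChoices-unique (k ∷ ks) = cartesianProduct⁺ (allFin⁺ (suc k)) (allChoices-unique ks)

length-allChoices : ∀ {r} (ns : Vec ℕ r) → length (allChoices ns) ≡ prodSuc ns
length-allChoices []       = refl
length-allChoices (k ∷ ks) = begin
  length (cartesianProduct (allFin (suc k)) (allChoices ks))
    ≡⟨ length-cartesianProduct (allFin (suc k)) (allChoices ks) ⟩
  length (allFin (suc k)) ℕ.* length (allChoices ks)
    ≡⟨ cong₂ ℕ._*_ (ListP.length-tabulate {n = suc k} id) (length-allChoices ks) ⟩
  suc k ℕ.* prodSuc ks
    ∎
  where open ≡-Reasoning

BlockIndex : ∀ {r} → Vec ℕ r → Set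
BlockIndex {r} ns = Σ (Fin r) (Fin ∘ lookup ns)

entry : ∀ {r} (ns : Vec ℕ r) (i : Fin r) → Fin (lookup ns i) → Fin (total ns)
entry (k ∷ ks) zero    m = m ↑ˡ total ks
entry (k ∷ ks) (suc i) m = k ↑ʳ entry ks i m

block : ∀ {r} (ns : Vec ℕ r) → Fin (total ns) → BlockIndex ns
block (k ∷ ks) l with splitAt k l
... | inj₁ m = zero , m
... | inj₂ l′ = let (i , m) = block ks l′ in suc i , m

entry-block : ∀ {r} (ns : Vec ℕ r) l → let (i , m) = block ns l in entry ns i m ≡ l
entry-block (k ∷ ks) l with splitAt k l in eq
... | inj₁ m  = trans (cong (join k (total ks)) (sym eq)) (FinP.join-splitAt k (total ks) l)
... | inj₂ l′ = trans (cong (k ↑ʳ_) (entry-block ks l′))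
                      (trans (cong (join k (total ks)) (sym eq)) (FinP.join-splitAt k (total ks) l))

block-entry : ∀ {r} (ns : Vec ℕ r) i m → block ns (entry ns i m) ≡ (i , m)
block-entry (k ∷ ks) zero    m rewrite FinP.splitAt-↑ˡ k m (total ks) = refl
block-entry (k ∷ ks) (suc i) m rewrite FinP.splitAt-↑ʳ k (total ks) (entry ks i m)
                                     | block-entry ks i m = refl

entry-injective : ∀ {r} (ns : Vec ℕ r) {i i′ m m′} → entry ns i m ≡ entry ns i′ m′ →
                  _≡_ {A = BlockIndex ns} (i , m) (i′ , m′)
entry-injective ns {i} {i′} {m} {m′} eq =
  trans (sym (block-entry ns i m)) (trans (cong (block ns) eq) (block-entry ns i′ m′))

entry-injectiveʳ : ∀ {r} (ns : Vec ℕ r) {i m m′} → entry ns i m ≡ entry ns i m′ → m ≡ m′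
entry-injectiveʳ ns eq with entry-injective ns eq
... | refl = refl

onEntries : ∀ {r} (ns : Vec ℕ r) {A : Set} → ((i : Fin r) → Fin (lookup ns i) → A) → Fin (total ns) → A
onEntries ns f l = let (i , m) = block ns l in f i m

onEntries-entry : ∀ {r} (ns : Vec ℕ r) {A : Set} (f : (i : Fin r) → Fin (lookup ns i) → A) i m →
                  onEntries ns f (entry ns i m) ≡ f i m
onEntries-entry ns f i m = cong (λ (i , m) → f i m) (block-entry ns i m)

byEntry : ∀ {r} (ns : Vec ℕ r) {P : Fin (total ns) → Set} → (∀ i m → P (entry ns i m)) → ∀ l → P l
byEntry ns {P} h l = subst P (entry-block ns l) (h (proj₁ (block ns l)) (proj₂ (block ns l)))

<ᵇ-suc : ∀ m n → (m <ᵇ suc n) ≡ (m ≤ᵇ n)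
<ᵇ-suc zero    n = refl
<ᵇ-suc (suc m) n = refl

+-cancelˡ-<ᵇ : ∀ x m n → (x ℕ.+ m <ᵇ x ℕ.+ n) ≡ (m <ᵇ n)
+-cancelˡ-<ᵇ zero    m n = refl
+-cancelˡ-<ᵇ (suc x) m n = +-cancelˡ-<ᵇ x m n

+-cancelˡ-≤ᵇ : ∀ x m n → (x ℕ.+ m ≤ᵇ x ℕ.+ n) ≡ (m ≤ᵇ n)
+-cancelˡ-≤ᵇ zero    m n = refl
+-cancelˡ-≤ᵇ (suc x) m n = trans (<ᵇ-suc (x ℕ.+ m) (x ℕ.+ n)) (+-cancelˡ-≤ᵇ x m n)

<ᵇ-true : ∀ {m n} → m ℕ.< n → (m <ᵇ n) ≡ true
<ᵇ-true {m} {n} m<n with m <ᵇ n | ℕP.<⇒<ᵇ m<n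
... | true | _ = refl

≤ᵇ-false : ∀ {m n} → n ℕ.< m → (m ≤ᵇ n) ≡ false
≤ᵇ-false {m} {n} n<m with m ≤ᵇ n in eq
... | false = refl
... | true  = contradiction (ℕP.≤ᵇ⇒≤ m n (subst T (sym eq) tt)) (ℕP.<⇒≱ n<m)

psum-zero : ∀ {r} (ns : Vec ℕ r) → psum ns 0 ≡ 0
psum-zero []      = refl
psum-zero (_ ∷ _) = refl

inBlock-entry : ∀ {r} (ns : Vec ℕ r) i m i′ → inBlock ns (toℕ (entry ns i m)) i′ ≡ does (i ≟ i′)
inBlock-entry (k ∷ ks) zero m zero
  rewrite FinP.toℕ-↑ˡ m (total ks) | psum-zero ks | ℕP.+-identityʳ k = <ᵇ-true (FinP.toℕ<n m)
inBlock-entry (k ∷ ks) zero m (suc i′)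
  rewrite FinP.toℕ-↑ˡ m (total ks) =
  cong (_∧ (toℕ m <ᵇ k ℕ.+ psum ks (suc (toℕ i′)))) (≤ᵇ-false (ℕP.<-≤-trans (FinP.toℕ<n m) (ℕP.m≤m+n k _)))
inBlock-entry (k ∷ ks) (suc i) m zero
  rewrite FinP.toℕ-↑ʳ k (entry ks i m) | psum-zero ks | ℕP.+-identityʳ k =
  ≤ᵇ-false (ℕP.m≤m+n (suc k) _)
inBlock-entry (k ∷ ks) (suc i) m (suc i′)
  rewrite FinP.toℕ-↑ʳ k (entry ks i m)
        | +-cancelˡ-≤ᵇ k (psum ks (toℕ i′)) (toℕ (entry ks i m))
        | +-cancelˡ-<ᵇ k (toℕ (entry ks i m)) (psum ks (suc (toℕ i′))) = inBlock-entry ks i m i′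

module Polytope {r : ℕ} (ns : Vec ℕ r) (b : Fin (total ns) → ℕ) where
  open import Data.Rational using (_≤_; _<_)

  n : ℕ
  n = total ns

  Coord : Set
  Coord = Fin (n ℕ.+ 1)

  lastCoord : Coord
  lastCoord = n ↑ʳ zero

  ↑ˡ≢lastCoord : ∀ l → l ↑ˡ 1 ≢ lastCoord
  ↑ˡ≢lastCoord l eq with () ← trans (sym (FinP.splitAt-↑ˡ n l 1)) (trans (cong (splitAt n) eq) (FinP.splitAt-↑ʳ n 1 zero))

  eIdx : Coord → Idx ns
  eIdx k = suc (k ↑ˡ r)

  eAt : (i : Fin r) → Fin (lookup ns i) → Idx ns
  eAt i m = eIdx (entry ns i m ↑ˡ 1)

  wIdx : Fin r → Idx ns
  wIdx i = suc ((n ℕ.+ 1) ↑ʳ i)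

  data VertexView : Idx ns → Set where
    origin : VertexView zero
    e      : ∀ k → VertexView (eIdx k)
    w      : ∀ i → VertexView (wIdx i)

  vertexView : ∀ j → VertexView j
  vertexView zero    = origin
  vertexView (suc j) = subst (VertexView ∘ suc) (FinP.join-splitAt (n ℕ.+ 1) r j) (view (splitAt (n ℕ.+ 1) j))
    where
    view : ∀ s → VertexView (suc (join (n ℕ.+ 1) r s))
    view (inj₁ k) = e k
    view (inj₂ i) = w i

  data CoordView : Coord → Set where
    entryCoord : ∀ i m → CoordView (entry ns i m ↑ˡ 1)
    last       : CoordView lastCoord

  coordView : ∀ k → CoordView k
  coordView k = subst CoordView (FinP.join-splitAt n 1 k) (view (splitAt n k))
    where
    view : ∀ s → CoordView (join n 1 s)
    view (inj₁ l)    = subst (CoordView ∘ (_↑ˡ 1)) (entry-block ns l) (entryCoord _ _)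
    view (inj₂ zero) = last

  onCoords : {A : Set} → (Fin n → A) → A → Coord → A
  onCoords f x k = [ f , (λ _ → x) ] (splitAt n k)

  onCoords-↑ˡ : ∀ {A : Set} (f : Fin n → A) x l → onCoords f x (l ↑ˡ 1) ≡ f l
  onCoords-↑ˡ f x l rewrite FinP.splitAt-↑ˡ n l 1 = refl

  onCoords-last : ∀ {A : Set} (f : Fin n → A) x → onCoords f x lastCoord ≡ x
  onCoords-last f x rewrite FinP.splitAt-↑ʳ n 1 zero = refl

  onVertices : {A : Set} → A → (Coord → A) → (Fin r → A) → Idx ns → A
  onVertices o f g zero    = o
  onVertices o f g (suc j) = [ f , g ] (splitAt (n ℕ.+ 1) j)

  onVertices-e : ∀ {A : Set} (o : A) f g k → onVertices o f g (eIdx k) ≡ f k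
  onVertices-e o f g k rewrite FinP.splitAt-↑ˡ (n ℕ.+ 1) k r = refl

  onVertices-w : ∀ {A : Set} (o : A) f g i → onVertices o f g (wIdx i) ≡ g i
  onVertices-w o f g i rewrite FinP.splitAt-↑ʳ (n ℕ.+ 1) r i = refl

  wCoord : Fin r → Fin n → ℚ
  wCoord i l = if inBlock ns (toℕ l) i then - ℕ→ℚ (b l) else 0ℚ

  wCoord-entry : ∀ i m i′ → wCoord i′ (entry ns i m) ≡ (if does (i ≟ i′) then - ℕ→ℚ (b (entry ns i m)) else 0ℚ)
  wCoord-entry i m i′ = cong (if_then _ else _) (inBlock-entry ns i m i′)

  wCoord-own : ∀ i m → wCoord i (entry ns i m) ≡ - ℕ→ℚ (b (entry ns i m))
  wCoord-own i m rewrite wCoord-entry i m i | dec-true (i ≟ i) refl = refl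

  wCoord-other : ∀ {i i′} m′ → i′ ≢ i → wCoord i (entry ns i′ m′) ≡ 0ℚ
  wCoord-other {i} {i′} m′ i′≢i = trans (wCoord-entry i′ m′ i)
    (cong (if_then - ℕ→ℚ (b (entry ns i′ m′)) else 0ℚ) (dec-false (i′ ≟ i) i′≢i))

  V-e : ∀ k → V ns b (eIdx k) ≗ basis n k
  V-e k c rewrite FinP.splitAt-↑ˡ (1 ℕ.+ (n ℕ.+ 1)) (suc k) r = refl

  V-w : ∀ i → V ns b (wIdx i) ≗ blockVertex ns b i
  V-w i c rewrite FinP.splitAt-↑ʳ (1 ℕ.+ (n ℕ.+ 1)) r i = refl

  V-w-↑ˡ : ∀ i l → V ns b (wIdx i) (l ↑ˡ 1) ≡ wCoord i l
  V-w-↑ˡ i l rewrite V-w i (l ↑ˡ 1) | FinP.splitAt-↑ˡ n l 1 = refl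

  V-w-last : ∀ i → V ns b (wIdx i) lastCoord ≡ 1ℚ
  V-w-last i rewrite V-w i lastCoord | FinP.splitAt-↑ʳ n 1 zero = refl

  dot-origin : ∀ a → dot a (V ns b zero) ≡ 0ℚ
  dot-origin = dot-zeroʳ

  dot-e : ∀ a k → dot a (V ns b (eIdx k)) ≡ a k
  dot-e a k = trans (dot-cong a (V-e k)) (dot-basis n a k)

  dot-w : ∀ a i → dot a (V ns b (wIdx i)) ≡ Σℚ (λ l → a (l ↑ˡ 1) * wCoord i l) + a lastCoord
  dot-w a i = begin
    dot a (V ns b (wIdx i))
      ≡⟨ Σℚ-↑ n _ ⟩
    Σℚ (λ l → a (l ↑ˡ 1) * V ns b (wIdx i) (l ↑ˡ 1)) + (a lastCoord * V ns b (wIdx i) lastCoord + 0ℚ)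
      ≡⟨ cong₂ _+_ (sum-cong-≗ (λ l → cong (a (l ↑ˡ 1) *_) (V-w-↑ˡ i l)))
                   (trans (ℚP.+-identityʳ _) (trans (cong (a lastCoord *_) (V-w-last i)) (ℚP.*-identityʳ _))) ⟩
    Σℚ (λ l → a (l ↑ˡ 1) * wCoord i l) + a lastCoord
      ∎
    where open ≡-Reasoning

  VertexSet : Set
  VertexSet = Subset ((1 ℕ.+ (n ℕ.+ 1)) ℕ.+ r)

  Gapped : VertexSet → Set
  Gapped S = ∀ i → wIdx i ∈ S → ∃ λ m → eAt i m ∉ S

  1+n≮n+1 : ¬ (suc n ℕ.< n ℕ.+ 1)
  1+n≮n+1 = ℕP.<-irrefl (ℕP.+-comm 1 n)

  module _ (S : VertexSet) where

    blockGap : (i : Fin r) → Maybe (Fin (lookup ns i))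
    blockGap i = Maybe.map proj₁ (dec⇒maybe (any? λ m → ¬? (eAt i m ∈? S)))

    blockGap-just : ∀ {i m} → blockGap i ≡ just m → eAt i m ∉ S
    blockGap-just {i} eq with any? (λ m → ¬? (eAt i m ∈? S))
    blockGap-just refl | yes (_ , eₘ∉S) = eₘ∉S

    blockGap-nothing : ∀ {i} → blockGap i ≡ nothing → ∀ m → eAt i m ∈ S
    blockGap-nothing {i} eq m with any? (λ m → ¬? (eAt i m ∈? S))
    blockGap-nothing {i} refl m | no none = decidable-stable (eAt i m ∈? S) (λ eₘ∉S → none (m , eₘ∉S))

    -- e_k is sent to k and wᵢ to the coordinate of an e_l of its block missing from S;
    -- lastCoord is only a filler for vertices that do not occur in S.
    witness : Idx ns → Coord
    witness = onVertices lastCoord id λ i → maybe (λ m → entry ns i m ↑ˡ 1) lastCoord (blockGap i)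

    witness-e : ∀ k → witness (eIdx k) ≡ k
    witness-e = onVertices-e lastCoord id _

    witness-w-just : ∀ {i m} → blockGap i ≡ just m → witness (wIdx i) ≡ entry ns i m ↑ˡ 1
    witness-w-just {i} eq rewrite onVertices-w lastCoord id (λ i → maybe (λ m → entry ns i m ↑ˡ 1) lastCoord (blockGap i)) i
                                | eq = refl

    blockGap-gapped : Gapped S → ∀ {i} → wIdx i ∈ S → ∃ λ m → blockGap i ≡ just m
    blockGap-gapped gapped {i} wᵢ∈S with blockGap i in eq
    ... | just m  = m , refl
    ... | nothing = let (m , eₘ∉S) = gapped i wᵢ∈S in contradiction (blockGap-nothing eq m) eₘ∉S

    witness-w : Gapped S → ∀ i → wIdx i ∈ S → ∃ λ m → witness (wIdx i) ≡ entry ns i m ↑ˡ 1 × eAt i m ∉ S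
    witness-w gapped i wᵢ∈S = let (m , gap) = blockGap-gapped gapped wᵢ∈S in m , witness-w-just gap , blockGap-just gap

  module _ {S : VertexSet} (0∉S : zero ∉ S) (gapped : Gapped S) where

    witness-injective : ∀ {j j′} → j ∈ S → j′ ∈ S → witness S j ≡ witness S j′ → j ≡ j′
    witness-injective {j} {j′} j∈S j′∈S eq with vertexView j | vertexView j′
    ... | origin | _      = contradiction j∈S 0∉S
    ... | e _    | origin = contradiction j′∈S 0∉S
    ... | w _    | origin = contradiction j′∈S 0∉S
    ... | e k    | e k′   = cong eIdx (trans (sym (witness-e S k)) (trans eq (witness-e S k′)))
    ... | e k    | w i′ with witness-w S gapped i′ j′∈S
    ...   | m′ , eq′ , e∉S =
      contradiction (subst (_∈ S) (cong eIdx (trans (sym (witness-e S k)) (trans eq eq′))) j∈S) e∉S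
    witness-injective j∈S j′∈S eq | w i | e k′ with witness-w S gapped i j∈S
    ...   | m , eq′ , e∉S =
      contradiction (subst (_∈ S) (cong eIdx (trans (sym (witness-e S k′)) (trans (sym eq) eq′))) j′∈S) e∉S
    witness-injective j∈S j′∈S eq | w i | w i′ with witness-w S gapped i j∈S | witness-w S gapped i′ j′∈S
    ... | m , eq₁ , _ | m′ , eq₂ , _ =
      cong (wIdx ∘ proj₁) (entry-injective ns (FinP.↑ˡ-injective 1 _ _ (trans (sym eq₁) (trans eq eq₂))))

    witness-faithful : ∀ {k} {f : Fin k → Idx ns} → (∀ i → f i ∈ S) →
                       ∀ {i i′} → witness S (f i) ≡ witness S (f i′) → V ns b (f i) ≗ V ns b (f i′)
    witness-faithful f∈S eq c = cong (λ j → V ns b j c) (witness-injective (f∈S _) (f∈S _) eq)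

    affIndep⊆-≤ : ∀ {k} {f : Fin k → Idx ns} → (∀ i → f i ∈ S) → AffIndep (V ns b ∘ f) → k ℕ.≤ n ℕ.+ 1
    affIndep⊆-≤ {f = f} f∈S indep = affIndep⇒≤ indep (witness S ∘ f) (witness-faithful f∈S)

    affIndep⊆-witnessed : ∀ {f : Fin (suc n) → Idx ns} → (∀ i → f i ∈ S) → AffIndep (V ns b ∘ f) →
                          ∀ q → ¬ (∀ j → j ∈ S → witness S j ≢ q)
    affIndep⊆-witnessed {f} f∈S indep q unwitnessed =
      1+n≮n+1 (affIndep⇒< indep (witness S ∘ f) (witness-faithful f∈S) q (λ i → unwitnessed (f i) (f∈S i)))

  drops : Choice ns → (i : Fin r) → Fin (lookup ns i) → Bool
  drops c i m = does (choiceAt c i ≟ suc m)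

  keepsE : Choice ns → (i : Fin r) → Fin (lookup ns i) → Bool
  keepsE c i m = not (drops c i m)

  keepsW : Choice ns → Fin r → Bool
  keepsW c i = not (does (choiceAt c i ≟ zero))

  -- choiceAt c i = zero: the facet contains every e_l of block i but not wᵢ;
  -- choiceAt c i = suc m: it contains wᵢ and every e_l of block i except the m-th.
  inFacet : Choice ns → Idx ns → Bool
  inFacet c = onVertices false (onCoords (onEntries ns (keepsE c)) true) (keepsW c)

  facetSet : Choice ns → VertexSet
  facetSet c = tabulate (inFacet c)

  inFacet-eAt : ∀ c i m → inFacet c (eAt i m) ≡ keepsE c i m
  inFacet-eAt c i m = begin
    inFacet c (eAt i m)
      ≡⟨ onVertices-e false _ (keepsW c) (entry ns i m ↑ˡ 1) ⟩
    onCoords (onEntries ns (keepsE c)) true (entry ns i m ↑ˡ 1)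
      ≡⟨ onCoords-↑ˡ (onEntries ns (keepsE c)) true (entry ns i m) ⟩
    onEntries ns (keepsE c) (entry ns i m)
      ≡⟨ onEntries-entry ns (keepsE c) i m ⟩
    keepsE c i m
      ∎
    where open ≡-Reasoning

  inFacet-eLast : ∀ c → inFacet c (eIdx lastCoord) ≡ true
  inFacet-eLast c = trans (onVertices-e false (onCoords (onEntries ns (keepsE c)) true) (keepsW c) lastCoord)
                          (onCoords-last (onEntries ns (keepsE c)) true)

  inFacet-w : ∀ c i → inFacet c (wIdx i) ≡ keepsW c i
  inFacet-w c = onVertices-w false (onCoords (onEntries ns (keepsE c)) true) (keepsW c)

  facetSet-injective : ∀ {c c′} → facetSet c ≡ facetSet c′ → c ≡ c′
  facetSet-injective {c} {c′} eq = choice-ext same-choice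
    where
    same : ∀ j → inFacet c j ≡ inFacet c′ j
    same j = trans (sym (VecP.lookup∘tabulate (inFacet c) j))
                   (trans (cong (λ S → lookup S j) eq) (VecP.lookup∘tabulate (inFacet c′) j))
    same-choice : ∀ i → choiceAt c i ≡ choiceAt c′ i
    same-choice i with choiceAt c i in cᵢ | choiceAt c′ i in c′ᵢ
                     | trans (sym (inFacet-w c i)) (trans (same (wIdx i)) (inFacet-w c′ i))
    ... | zero  | zero   | _  = refl
    ... | zero  | suc _  | ()
    ... | suc _ | zero   | ()
    ... | suc m | suc m′ | _ with m′ ≟ m
    ...   | yes m′≡m = cong suc (sym m′≡m)
    ...   | no m′≢m  = contradiction (begin
      false          ≡⟨ cong not (dec-true (choiceAt c i ≟ suc m) cᵢ) ⟨
      keepsE c i m   ≡⟨ trans (sym (inFacet-eAt c i m)) (trans (same (eAt i m)) (inFacet-eAt c′ i m)) ⟩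
      keepsE c′ i m  ≡⟨ cong not (dec-false (choiceAt c′ i ≟ suc m) (m′≢m ∘ suc-injective ∘ trans (sym c′ᵢ))) ⟩
      true           ∎) λ ()
      where open ≡-Reasoning

  module Positive (b>0 : ∀ l → 0 ℕ.< b l) (ns>0 : ∀ i → 0 ℕ.< lookup ns i) where

    bℚ : Fin n → ℚ
    bℚ l = ℕ→ℚ (b l)

    instance
      bℚ-positive : ∀ {l} → Positive (bℚ l)
      bℚ-positive {l} = ℕ→ℚ-pos (b l) (b>0 l)

      bℚ-nonZero : ∀ {l} → NonZero (bℚ l)
      bℚ-nonZero {l} = ℚP.pos⇒nonZero (bℚ l)

    wCoord≤0 : ∀ i l → wCoord i l ≤ 0ℚ
    wCoord≤0 i l with inBlock ns (toℕ l) i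
    ... | true  = ℚP.<⇒≤ (ℚP.neg-antimono-< (ℚP.positive⁻¹ (bℚ l)))
    ... | false = ℚP.≤-refl

    someEntry : ∀ i → Fin (lookup ns i)
    someEntry i = fromℕ< (ns>0 i)

    Σ-weighted-wCoord<0 : ∀ (a : Fin n → ℚ) x i → 0ℚ < x → (∀ m → a (entry ns i m) ≡ x) →
                        Σℚ (λ l → a l * wCoord i l) < 0ℚ
    Σ-weighted-wCoord<0 a x i x>0 a≡x = Σℚ-neg _ (byEntry ns term≤0) (entry ns i (someEntry i)) term<0
      where
      instance
        _ = positive x>0
        _ = ℚP.pos⇒nonNeg x
      term≤0 : ∀ i′ m′ → a (entry ns i′ m′) * wCoord i (entry ns i′ m′) ≤ 0ℚ
      term≤0 i′ m′ with i′ ≟ i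
      ... | yes refl rewrite a≡x m′ =
        subst (x * wCoord i (entry ns i m′) ≤_) (ℚP.*-zeroʳ x) (ℚP.*-monoˡ-≤-nonNeg x (wCoord≤0 i (entry ns i m′)))
      ... | no i′≢i rewrite wCoord-other {i} m′ i′≢i = ℚP.≤-reflexive (ℚP.*-zeroʳ (a (entry ns i′ m′)))
      term<0 : a (entry ns i (someEntry i)) * wCoord i (entry ns i (someEntry i)) < 0ℚ
      term<0 rewrite a≡x (someEntry i) | wCoord-own i (someEntry i) =
        subst (x * - bℚ (entry ns i (someEntry i)) <_) (ℚP.*-zeroʳ x)
              (ℚP.*-monoʳ-<-pos x (ℚP.neg-antimono-< (ℚP.positive⁻¹ (bℚ (entry ns i (someEntry i))))))

    σ : Fin r → ℚ
    σ i = Σℚ (wCoord i)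

    σ<0 : ∀ i → σ i < 0ℚ
    σ<0 i = subst (_< 0ℚ) (sum-cong-≗ (ℚP.*-identityˡ ∘ wCoord i))
                  (Σ-weighted-wCoord<0 (λ _ → 1ℚ) 1ℚ i (ℚP.positive⁻¹ 1ℚ) (λ _ → refl))

    module _ (c : Choice ns) where

      -- The entry σᵢ / b_l at the omitted coordinate l of block i is what makes normal · wᵢ = 1.
      correctionAt : (i : Fin r) → Fin (lookup ns i) → ℚ
      correctionAt i m = if drops c i m then σ i * 1/ bℚ (entry ns i m) else 0ℚ

      correction : Fin n → ℚ
      correction = onEntries ns correctionAt

      normal : Coord → ℚ
      normal = onCoords (λ l → correction l + 1ℚ) 1ℚ

      correction-kept : ∀ i m → choiceAt c i ≢ suc m → correction (entry ns i m) ≡ 0ℚ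
      correction-kept i m cᵢ≢m = trans (onEntries-entry ns correctionAt i m)
        (cong (if_then σ i * 1/ bℚ (entry ns i m) else 0ℚ) (dec-false (choiceAt c i ≟ suc m) cᵢ≢m))

      correction-dropped : ∀ i m → choiceAt c i ≡ suc m → correction (entry ns i m) ≡ σ i * 1/ bℚ (entry ns i m)
      correction-dropped i m cᵢ≡m = trans (onEntries-entry ns correctionAt i m)
        (cong (if_then σ i * 1/ bℚ (entry ns i m) else 0ℚ) (dec-true (choiceAt c i ≟ suc m) cᵢ≡m))

      correction-dropped<0 : ∀ i m → choiceAt c i ≡ suc m → correction (entry ns i m) < 0ℚ
      correction-dropped<0 i m cᵢ≡m = subst (_< 0ℚ) (sym (correction-dropped i m cᵢ≡m))
        (ℚP.negative⁻¹ (σ i * 1/ bℚ l)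
          {{ℚP.neg*pos⇒neg (σ i) {{negative (σ<0 i)}} (1/ bℚ l) {{ℚP.1/pos⇒pos (bℚ l)}}}})
        where l = entry ns i m

      correction*wCoord≡0 : ∀ i i′ m′ → (i′ ≡ i → choiceAt c i′ ≢ suc m′) →
                            correction (entry ns i′ m′) * wCoord i (entry ns i′ m′) ≡ 0ℚ
      correction*wCoord≡0 i i′ m′ kept with i′ ≟ i
      ... | no i′≢i  = trans (cong (correction (entry ns i′ m′) *_) (wCoord-other m′ i′≢i))
                             (ℚP.*-zeroʳ (correction (entry ns i′ m′)))
      ... | yes refl = trans (cong (_* wCoord i (entry ns i m′)) (correction-kept i m′ (kept refl)))
                             (ℚP.*-zeroˡ (wCoord i (entry ns i m′)))

      Σcorrection*wCoord-kept : ∀ i → choiceAt c i ≡ zero → Σℚ (λ l → correction l * wCoord i l) ≡ 0ℚ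
      Σcorrection*wCoord-kept i cᵢ≡0 = Σℚ-zero (byEntry ns λ i′ m′ →
        correction*wCoord≡0 i i′ m′ λ { refl cᵢ≡m′ → contradiction (trans (sym cᵢ≡0) cᵢ≡m′) λ () })

      Σcorrection*wCoord-dropped : ∀ i m → choiceAt c i ≡ suc m → Σℚ (λ l → correction l * wCoord i l) ≡ - σ i
      Σcorrection*wCoord-dropped i m cᵢ≡m = begin
        Σℚ (λ l → correction l * wCoord i l)
          ≡⟨ Σℚ-single _ l₀ (byEntry ns {P = λ l → l ≢ l₀ → correction l * wCoord i l ≡ 0ℚ} λ i′ m′ m′≢m →
               correction*wCoord≡0 i i′ m′ λ { refl cᵢ≡m′ →
                 m′≢m (cong (entry ns i) (suc-injective (trans (sym cᵢ≡m′) cᵢ≡m))) }) ⟩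
        correction l₀ * wCoord i l₀
          ≡⟨ cong₂ _*_ (correction-dropped i m cᵢ≡m) (wCoord-own i m) ⟩
        (σ i * 1/ bℚ l₀) * - bℚ l₀
          ≡⟨ p*[1/q]*-q≡-p (σ i) (bℚ l₀) ⟩
        - σ i
          ∎
        where
        open ≡-Reasoning
        l₀ = entry ns i m

      normal-entry : ∀ l → normal (l ↑ˡ 1) ≡ correction l + 1ℚ
      normal-entry = onCoords-↑ˡ (λ l → correction l + 1ℚ) 1ℚ

      normal-last : normal lastCoord ≡ 1ℚ
      normal-last = onCoords-last (λ l → correction l + 1ℚ) 1ℚ

      dot-normal-w : ∀ i → dot normal (V ns b (wIdx i)) ≡ (Σℚ (λ l → correction l * wCoord i l) + σ i) + 1ℚ
      dot-normal-w i = begin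
        dot normal (V ns b (wIdx i))
          ≡⟨ dot-w normal i ⟩
        Σℚ (λ l → normal (l ↑ˡ 1) * wCoord i l) + normal lastCoord
          ≡⟨ cong₂ _+_ (sum-cong-≗ distrib) normal-last ⟩
        Σℚ (λ l → correction l * wCoord i l + wCoord i l) + 1ℚ
          ≡⟨ cong (_+ 1ℚ) (∑-distrib-+ (λ l → correction l * wCoord i l) (wCoord i)) ⟩
        (Σℚ (λ l → correction l * wCoord i l) + σ i) + 1ℚ
          ∎
        where
        open ≡-Reasoning
        distrib : ∀ l → normal (l ↑ˡ 1) * wCoord i l ≡ correction l * wCoord i l + wCoord i l
        distrib l = begin
          normal (l ↑ˡ 1) * wCoord i l                ≡⟨ cong (_* wCoord i l) (normal-entry l) ⟩
          (correction l + 1ℚ) * wCoord i l            ≡⟨ ℚP.*-distribʳ-+ (wCoord i l) (correction l) 1ℚ ⟩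
          correction l * wCoord i l + 1ℚ * wCoord i l ≡⟨ cong (correction l * wCoord i l +_) (ℚP.*-identityˡ (wCoord i l)) ⟩
          correction l * wCoord i l + wCoord i l      ∎

      tight-eAt : ∀ i m → Tight (keepsE c i m) (correction (entry ns i m) + 1ℚ)
      tight-eAt i m with choiceAt c i ≟ suc m
      ... | yes cᵢ≡m = p<0⇒p+1<1 (correction-dropped<0 i m cᵢ≡m)
      ... | no cᵢ≢m  = trans (cong (_+ 1ℚ) (correction-kept i m cᵢ≢m)) (ℚP.+-identityˡ 1ℚ)

      tight-w : ∀ i → Tight (keepsW c i) ((Σℚ (λ l → correction l * wCoord i l) + σ i) + 1ℚ)
      tight-w i with choiceAt c i in cᵢ
      ... | zero  = subst (λ x → x + 1ℚ < 1ℚ)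
                          (sym (trans (cong (_+ σ i) (Σcorrection*wCoord-kept i cᵢ)) (ℚP.+-identityˡ (σ i))))
                          (p<0⇒p+1<1 (σ<0 i))
      ... | suc m = begin
        (Σℚ (λ l → correction l * wCoord i l) + σ i) + 1ℚ
          ≡⟨ cong (λ x → (x + σ i) + 1ℚ) (Σcorrection*wCoord-dropped i m cᵢ) ⟩
        (- σ i + σ i) + 1ℚ
          ≡⟨ cong (_+ 1ℚ) (ℚP.+-inverseˡ (σ i)) ⟩
        0ℚ + 1ℚ
          ≡⟨ ℚP.+-identityˡ 1ℚ ⟩
        1ℚ
          ∎
        where open ≡-Reasoning

      normal-tight : ∀ j → Tight (inFacet c j) (dot normal (V ns b j))
      normal-tight j with vertexView j
      ... | origin = subst (_< 1ℚ) (sym (dot-origin normal)) (ℚP.positive⁻¹ 1ℚ)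
      ... | w i    = subst₂ Tight (sym (inFacet-w c i)) (sym (dot-normal-w i)) (tight-w i)
      ... | e k with coordView k
      ...   | entryCoord i m = subst₂ Tight (sym (inFacet-eAt c i m))
                                       (sym (trans (dot-e normal (entry ns i m ↑ˡ 1)) (normal-entry (entry ns i m))))
                                       (tight-eAt i m)
      ...   | last           = subst₂ Tight (sym (inFacet-eLast c)) (sym (trans (dot-e normal lastCoord) normal-last)) refl

      normal≢0 : ¬ (∀ k → normal k ≡ 0ℚ)
      normal≢0 normal≡0 with () ← trans (sym normal-last) (normal≡0 lastCoord)

      facetSet-face : IsProperFaceWithVertices (V ns b) (facetSet c)
      facetSet-face = normal , 1ℚ , normal≢0 , Tight⇒≤ ∘ normal-tight ,
                      λ j → ⇔.trans (Tight⇒⇔ (normal-tight j)) (⇔.sym (∈-tabulate (inFacet c) j))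

      listedAt : (i : Fin r) → Fin (lookup ns i) → Idx ns
      listedAt i m = if drops c i m then wIdx i else eAt i m

      listed : Fin (suc n) → Idx ns
      listed zero    = eIdx lastCoord
      listed (suc l) = onEntries ns listedAt l

      listed-dropped : ∀ i m → choiceAt c i ≡ suc m → listed (suc (entry ns i m)) ≡ wIdx i
      listed-dropped i m cᵢ≡m = trans (onEntries-entry ns listedAt i m)
        (cong (if_then wIdx i else eAt i m) (dec-true (choiceAt c i ≟ suc m) cᵢ≡m))

      listed-kept : ∀ i m → choiceAt c i ≢ suc m → listed (suc (entry ns i m)) ≡ eAt i m
      listed-kept i m cᵢ≢m = trans (onEntries-entry ns listedAt i m)
        (cong (if_then wIdx i else eAt i m) (dec-false (choiceAt c i ≟ suc m) cᵢ≢m))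

      listed∈facetSet : ∀ k → listed k ∈ facetSet c
      listed∈facetSet k = Equivalence.from (∈-tabulate (inFacet c) (listed k)) (inFacet-listed k)
        where
        inFacet-listed : ∀ k → inFacet c (listed k) ≡ true
        inFacet-listed zero = inFacet-eLast c
        inFacet-listed (suc l) = byEntry ns {P = λ l → inFacet c (listed (suc l)) ≡ true} in-entry l
          where
          in-entry : ∀ i m → inFacet c (listed (suc (entry ns i m))) ≡ true
          in-entry i m with choiceAt c i ≟ suc m
          ... | yes cᵢ≡m = trans (cong (inFacet c) (listed-dropped i m cᵢ≡m))
                                 (trans (inFacet-w c i) (cong (λ x → not (does (x ≟ zero))) cᵢ≡m))
          ... | no cᵢ≢m  = trans (cong (inFacet c) (listed-kept i m cᵢ≢m))
                                 (trans (inFacet-eAt c i m) (cong not (dec-false (choiceAt c i ≟ suc m) cᵢ≢m)))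

      listed-zero-coord : ∀ l → V ns b (listed zero) (l ↑ˡ 1) ≡ 0ℚ
      listed-zero-coord l = trans (V-e lastCoord (l ↑ˡ 1)) (basis-off n lastCoord (l ↑ˡ 1) (↑ˡ≢lastCoord l))

      listed-dropped-coord : ∀ i m → choiceAt c i ≡ suc m →
                             ∀ l → V ns b (listed (suc (entry ns i m))) (l ↑ˡ 1) ≡ wCoord i l
      listed-dropped-coord i m cᵢ≡m l = trans (cong (λ j → V ns b j (l ↑ˡ 1)) (listed-dropped i m cᵢ≡m)) (V-w-↑ˡ i l)

      listed-kept-coord : ∀ i m → choiceAt c i ≢ suc m →
                          V ns b (listed (suc (entry ns i m))) ≗ basis n (entry ns i m ↑ˡ 1)
      listed-kept-coord i m cᵢ≢m k = trans (cong (λ j → V ns b j k) (listed-kept i m cᵢ≢m)) (V-e _ k)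

      -- Elimination column by column: in the column of an omitted coordinate l only wᵢ has a
      -- nonzero entry (−b_l), so its coefficient vanishes; then in the column of a kept
      -- coordinate l only e_l is left; finally Σ t = 0 kills the coefficient of e_{n+1}.
      listed-affIndep : AffIndep (V ns b ∘ listed)
      listed-affIndep t Σt≡0 Σtv≡0 = t≡0
        where
        open ≡-Reasoning

        P : Fin (suc n) → Fin n → ℚ
        P k l = V ns b (listed k) (l ↑ˡ 1)

        vanishes-at : ∀ {k l} → P k l ≡ 0ℚ → t k * P k l ≡ 0ℚ
        vanishes-at {k} {l} Pₖₗ≡0 = trans (cong (t k *_) Pₖₗ≡0) (ℚP.*-zeroʳ (t k))

        column : ∀ l → (∀ k → k ≢ suc l → t k * P k l ≡ 0ℚ) → t (suc l) * P (suc l) l ≡ 0ℚ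
        column l others = trans (sym (Σℚ-single (λ k → t k * P k l) (suc l) others)) (Σtv≡0 (l ↑ˡ 1))

        kept-off : ∀ {i m l} → choiceAt c i ≢ suc m → suc (entry ns i m) ≢ suc l → P (suc (entry ns i m)) l ≡ 0ℚ
        kept-off {i} {m} {l} cᵢ≢m ne = trans (listed-kept-coord i m cᵢ≢m (l ↑ˡ 1))
          (basis-off n (entry ns i m ↑ˡ 1) (l ↑ˡ 1) (ne ∘ cong suc ∘ sym ∘ FinP.↑ˡ-injective 1 l (entry ns i m)))

        t-dropped : ∀ i m → choiceAt c i ≡ suc m → t (suc (entry ns i m)) ≡ 0ℚ
        t-dropped i m cᵢ≡m =
          p*q≡0⇒p≡0 (t (suc l₀)) (- bℚ l₀) {{ℚP.neg⇒nonZero (- bℚ l₀) {{ℚP.neg-pos {bℚ l₀} bℚ-positive}}}}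
          (begin
            t (suc l₀) * - bℚ l₀
              ≡⟨ cong (t (suc l₀) *_) (trans (listed-dropped-coord i m cᵢ≡m l₀) (wCoord-own i m)) ⟨
            t (suc l₀) * P (suc l₀) l₀
              ≡⟨ column l₀ others ⟩
            0ℚ
              ∎)
          where
          l₀ = entry ns i m
          off : ∀ i′ m′ → suc (entry ns i′ m′) ≢ suc l₀ → P (suc (entry ns i′ m′)) l₀ ≡ 0ℚ
          off i′ m′ ne with choiceAt c i′ ≟ suc m′
          ... | no cᵢ′≢m′  = kept-off cᵢ′≢m′ ne
          ... | yes cᵢ′≡m′ with i′ ≟ i
          ...   | no i′≢i  = trans (listed-dropped-coord i′ m′ cᵢ′≡m′ l₀) (wCoord-other m (i′≢i ∘ sym))
          ...   | yes refl = contradiction (cong (suc ∘ entry ns i) (suc-injective (trans (sym cᵢ′≡m′) cᵢ≡m))) ne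
          others : ∀ k → k ≢ suc l₀ → t k * P k l₀ ≡ 0ℚ
          others zero    _ = vanishes-at (listed-zero-coord l₀)
          others (suc l) = byEntry ns {P = λ l → suc l ≢ suc l₀ → t (suc l) * P (suc l) l₀ ≡ 0ℚ}
                                   (λ i′ m′ ne → vanishes-at (off i′ m′ ne)) l

        t-kept : ∀ i m → choiceAt c i ≢ suc m → t (suc (entry ns i m)) ≡ 0ℚ
        t-kept i m cᵢ≢m = begin
          t (suc l₀)
            ≡⟨ ℚP.*-identityʳ (t (suc l₀)) ⟨
          t (suc l₀) * 1ℚ
            ≡⟨ cong (t (suc l₀) *_) (trans (listed-kept-coord i m cᵢ≢m (l₀ ↑ˡ 1)) (basis-diag n (l₀ ↑ˡ 1))) ⟨
          t (suc l₀) * P (suc l₀) l₀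
            ≡⟨ column l₀ others ⟩
          0ℚ
            ∎
          where
          l₀ = entry ns i m
          term≡0 : ∀ i′ m′ → suc (entry ns i′ m′) ≢ suc l₀ →
                   t (suc (entry ns i′ m′)) * P (suc (entry ns i′ m′)) l₀ ≡ 0ℚ
          term≡0 i′ m′ ne with choiceAt c i′ ≟ suc m′
          ... | yes cᵢ′≡m′ = trans (cong (_* P (suc (entry ns i′ m′)) l₀) (t-dropped i′ m′ cᵢ′≡m′))
                                   (ℚP.*-zeroˡ (P (suc (entry ns i′ m′)) l₀))
          ... | no cᵢ′≢m′  = vanishes-at (kept-off cᵢ′≢m′ ne)
          others : ∀ k → k ≢ suc l₀ → t k * P k l₀ ≡ 0ℚ
          others zero    _ = vanishes-at (listed-zero-coord l₀)
          others (suc l) = byEntry ns {P = λ l → suc l ≢ suc l₀ → t (suc l) * P (suc l) l₀ ≡ 0ℚ} term≡0 l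

        t-suc≡0 : ∀ l → t (suc l) ≡ 0ℚ
        t-suc≡0 = byEntry ns t-entry
          where
          t-entry : ∀ i m → t (suc (entry ns i m)) ≡ 0ℚ
          t-entry i m with choiceAt c i ≟ suc m
          ... | yes cᵢ≡m = t-dropped i m cᵢ≡m
          ... | no cᵢ≢m  = t-kept i m cᵢ≢m

        t≡0 : ∀ k → t k ≡ 0ℚ
        t≡0 zero = begin
          t zero                   ≡⟨ ℚP.+-identityʳ (t zero) ⟨
          t zero + 0ℚ              ≡⟨ cong (t zero +_) (Σℚ-zero t-suc≡0) ⟨
          t zero + Σℚ (t ∘ suc)    ≡⟨ Σt≡0 ⟩
          0ℚ                       ∎
        t≡0 (suc l) = t-suc≡0 l

    ∈facetSet⇒ : ∀ {c j} → j ∈ facetSet c → inFacet c j ≡ true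
    ∈facetSet⇒ {c} {j} = Equivalence.to (∈-tabulate (inFacet c) j)

    facetSet-gapped : ∀ c → Gapped (facetSet c)
    facetSet-gapped c i wᵢ∈ with choiceAt c i in cᵢ | trans (sym (inFacet-w c i)) (∈facetSet⇒ wᵢ∈)
    ... | zero  | ()
    ... | suc m | _ = m , λ eₘ∈ → contradiction
      (trans (sym (∈facetSet⇒ eₘ∈)) (trans (inFacet-eAt c i m) (cong not (dec-true (choiceAt c i ≟ suc m) cᵢ)))) λ ()

    0∉facetSet : ∀ c → zero ∉ facetSet c
    0∉facetSet c 0∈ with () ← ∈facetSet⇒ 0∈

    facetSet-isFacet : ∀ c → IsFacetAvoidingOrigin ns b (facetSet c)
    facetSet-isFacet c =
      facetSet-face c ,
      ((listed c , listed∈facetSet c , listed-affIndep c) ,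
       λ (f , f∈ , indep) → 1+n≮n+1 (affIndep⊆-≤ (0∉facetSet c) (facetSet-gapped c) f∈ indep)) ,
      0∉facetSet c

    module FacetToChoice (S : VertexSet) (0∉S : zero ∉ S) (a : Coord → ℚ) (h : ℚ)
                         (a≤h : ∀ j → dot a (V ns b j) ≤ h) (on-hyperplane : ∀ j → (dot a (V ns b j) ≡ h) ⇔ (j ∈ S))
                         {f : Fin (suc n) → Idx ns} (f∈S : ∀ k → f k ∈ S) (indep : AffIndep (V ns b ∘ f)) where

      ∈S⇒tight : ∀ {j} → j ∈ S → dot a (V ns b j) ≡ h
      ∈S⇒tight = Equivalence.from (on-hyperplane _)

      h>0 : 0ℚ < h
      h>0 = ≤∧≢⇒< (subst (_≤ h) (dot-origin a) (a≤h zero))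
                  (λ 0≡h → 0∉S (Equivalence.to (on-hyperplane zero) (trans (dot-origin a) 0≡h)))

      -- If all of block i were in S, then a = h on the block and a · wᵢ < h.
      gapped : Gapped S
      gapped i wᵢ∈S with blockGap S i in eq
      ... | just m  = m , blockGap-just S eq
      ... | nothing = contradiction (∈S⇒tight wᵢ∈S) (ℚP.<⇒≢ below)
        where
        a≡h : ∀ m → a (entry ns i m ↑ˡ 1) ≡ h
        a≡h m = trans (sym (dot-e a _)) (∈S⇒tight (blockGap-nothing S eq m))
        below : dot a (V ns b (wIdx i)) < h
        below = begin-strict
          dot a (V ns b (wIdx i))
            ≡⟨ dot-w a i ⟩
          Σℚ (λ l → a (l ↑ˡ 1) * wCoord i l) + a lastCoord
            <⟨ ℚP.+-mono-<-≤ (Σ-weighted-wCoord<0 (λ l → a (l ↑ˡ 1)) h i h>0 a≡h)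
                             (subst (_≤ h) (dot-e a lastCoord) (a≤h (eIdx lastCoord))) ⟩
          0ℚ + h
            ≡⟨ ℚP.+-identityˡ h ⟩
          h
            ∎
          where open ℚP.≤-Reasoning

      eIdx∈S : ∀ q → (∀ i → wIdx i ∈ S → witness S (wIdx i) ≢ q) → eIdx q ∈ S
      eIdx∈S q w-misses with eIdx q ∈? S
      ... | yes eq∈S = eq∈S
      ... | no eq∉S  = contradiction unwitnessed (affIndep⊆-witnessed 0∉S gapped f∈S indep q)
        where
        unwitnessed : ∀ j → j ∈ S → witness S j ≢ q
        unwitnessed j j∈S with vertexView j
        ... | origin = contradiction j∈S 0∉S
        ... | e k    = λ k≡q → eq∉S (subst (_∈ S) (cong eIdx (trans (sym (witness-e S k)) k≡q)) j∈S)
        ... | w i    = w-misses i j∈S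

      eLast∈S : eIdx lastCoord ∈ S
      eLast∈S = eIdx∈S lastCoord λ i wᵢ∈S → let (m , eq , _) = witness-w S gapped i wᵢ∈S in
        λ eq′ → ↑ˡ≢lastCoord _ (trans (sym eq) eq′)

      eAt∈S : ∀ i m → (wIdx i ∈ S → witness S (wIdx i) ≢ entry ns i m ↑ˡ 1) → eAt i m ∈ S
      eAt∈S i m own-misses = eIdx∈S _ misses
        where
        misses : ∀ i′ → wIdx i′ ∈ S → witness S (wIdx i′) ≢ entry ns i m ↑ˡ 1
        misses i′ wᵢ′∈S with i′ ≟ i
        ... | yes refl = own-misses wᵢ′∈S
        ... | no i′≢i  = λ eq′ → let (m′ , eq , _) = witness-w S gapped i′ wᵢ′∈S in
          i′≢i (cong proj₁ (entry-injective ns (FinP.↑ˡ-injective 1 _ _ (trans (sym eq) eq′))))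

      decodeAt : (i : Fin r) → Fin (suc (lookup ns i))
      decodeAt i = if does (wIdx i ∈? S) then maybe suc zero (blockGap S i) else zero

      decoded : Choice ns
      decoded = tabulateChoice decodeAt

      decoded-∉ : ∀ {i} → wIdx i ∉ S → choiceAt decoded i ≡ zero
      decoded-∉ {i} wᵢ∉S = trans (choiceAt-tabulate {ns = ns} decodeAt i)
        (cong (if_then maybe suc zero (blockGap S i) else zero) (dec-false (wIdx i ∈? S) wᵢ∉S))

      decoded-gap : ∀ {i m} → wIdx i ∈ S → blockGap S i ≡ just m → choiceAt decoded i ≡ suc m
      decoded-gap {i} wᵢ∈S gap = trans (choiceAt-tabulate {ns = ns} decodeAt i)
        (trans (cong (if_then maybe suc zero (blockGap S i) else zero) (dec-true (wIdx i ∈? S) wᵢ∈S))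
               (cong (maybe suc zero) gap))

      Agree : Idx ns → Set
      Agree j = (j ∈ S → inFacet decoded j ≡ true) × (inFacet decoded j ≡ true → j ∈ S)

      both-in : ∀ {j} → j ∈ S → inFacet decoded j ≡ true → Agree j
      both-in j∈S in-facet = (λ _ → in-facet) , (λ _ → j∈S)

      both-out : ∀ {j} → j ∉ S → inFacet decoded j ≡ false → Agree j
      both-out j∉S out-facet = (λ j∈S → contradiction j∈S j∉S) ,
                               (λ in-facet → contradiction (trans (sym out-facet) in-facet) λ ())

      agree-w : ∀ i → Agree (wIdx i)
      agree-w i with wIdx i ∈? S
      ... | no wᵢ∉S  =
        both-out wᵢ∉S (trans (inFacet-w decoded i) (cong (λ x → not (does (x ≟ zero))) (decoded-∉ wᵢ∉S)))
      ... | yes wᵢ∈S = let (m , gap) = blockGap-gapped S gapped wᵢ∈S in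
        both-in wᵢ∈S (trans (inFacet-w decoded i) (cong (λ x → not (does (x ≟ zero))) (decoded-gap wᵢ∈S gap)))

      agree-eAt : ∀ i m → Agree (eAt i m)
      agree-eAt i m with wIdx i ∈? S
      ... | no wᵢ∉S = both-in (eAt∈S i m (λ wᵢ∈S → contradiction wᵢ∈S wᵢ∉S))
                              (trans (inFacet-eAt decoded i m) (cong (λ x → not (does (x ≟ suc m))) (decoded-∉ wᵢ∉S)))
      ... | yes wᵢ∈S with blockGap-gapped S gapped wᵢ∈S
      ...   | m* , gap with m* ≟ m
      ...     | yes refl = both-out (blockGap-just S gap)
                                    (trans (inFacet-eAt decoded i m)
                                           (cong not (dec-true (choiceAt decoded i ≟ suc m) (decoded-gap wᵢ∈S gap))))
      ...     | no m*≢m  = both-in (eAt∈S i m λ _ eq →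
                                     m*≢m (entry-injectiveʳ ns (FinP.↑ˡ-injective 1 _ _ (trans (sym (witness-w-just S gap)) eq))))
                                   (trans (inFacet-eAt decoded i m) (cong not (dec-false (choiceAt decoded i ≟ suc m)
                                     (m*≢m ∘ suc-injective ∘ trans (sym (decoded-gap wᵢ∈S gap))))))

      agree : ∀ j → Agree j
      agree j with vertexView j
      ... | origin = both-out 0∉S refl
      ... | w i    = agree-w i
      ... | e k with coordView k
      ...   | last           = both-in eLast∈S (inFacet-eLast decoded)
      ...   | entryCoord i m = agree-eAt i m

      S≡facetSet : S ≡ facetSet decoded
      S≡facetSet = ⊆-antisym (λ {j} j∈S → Equivalence.from (∈-tabulate (inFacet decoded) j) (proj₁ (agree j) j∈S))
                             (λ {j} j∈F → proj₂ (agree j) (Equivalence.to (∈-tabulate (inFacet decoded) j) j∈F))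

    isFacet⇒facetSet : ∀ {S} → IsFacetAvoidingOrigin ns b S → ∃ λ c → S ≡ facetSet c
    isFacet⇒facetSet ((a , h , _ , a≤h , on-hyperplane) , ((f , f∈S , indep) , _) , 0∉S) = decoded , S≡facetSet
      where open FacetToChoice _ 0∉S a h a≤h on-hyperplane f∈S indep

open import Data.Nat using (_≤_; _<_)

proposition3p5 : (r : ℕ) → 1 ≤ r → (ns : Vec ℕ r) → All (λ k → 0 < k) ns →
    (b : Fin (total ns) → ℕ) → (∀ l → 0 < b l) →
    HasCount (IsFacetAvoidingOrigin ns b) (prodSuc ns)
proposition3p5 r _ ns ns>0 b b>0 =
  map facetSet (allChoices ns) ,
  map⁺ facetSet-injective (allChoices-unique ns) ,
  trans (ListP.length-map facetSet (allChoices ns)) (length-allChoices ns) ,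
  λ _ → mk⇔ facet⇒listed listed⇒facet
  where
  open Polytope ns b
  open Positive b>0 (lookup⁺ ns>0)
  facet⇒listed : ∀ {S} → IsFacetAvoidingOrigin ns b S → S ∈ₗ map facetSet (allChoices ns)
  facet⇒listed facet with isFacet⇒facetSet facet
  ... | c , refl = ∈-map⁺ facetSet (∈-allChoices ns c)
  listed⇒facet : ∀ {S} → S ∈ₗ map facetSet (allChoices ns) → IsFacetAvoidingOrigin ns b S
  listed⇒facet S∈ with ∈-map⁻ facetSet S∈
  ... | c , _ , refl = facetSet-isFacet c
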